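{- Let $b\ge2$ be an integer, $A=\{1,b\}$, and let $X$ be a nonempty finite binary string with no subperiod (i.e. the infinite word $X^\infty$ has least period $|X|$). Then $X^\infty\in\mathcal W^A$ if and only if $|X|$ divides $1+b$ and $X$ is a cyclic rotation of a concatenation of copies of the blocks $01$ and $011$.
   Context: For a finite nonempty set $A$ of positive integers let $\alpha=\max A$. For a seed $S=s_1\cdots s_\alpha\in\{0,1\}^\alpha$, define $w^{A,S}(-\alpha-1+j)=s_j$ for $j=1,\ldots,\alpha$ and $w^{A,S}(n)=1-\min\{w^{A,S}(n-x):x\in A\}$ for $n\ge0$. $\mathcal W^A=\{(w^{A,S}(n))_{n\ge0}: S\in\{0,1\}^\alpha\}$. $X^\infty$ denotes the infinite word $XXX\cdots$, indexed from $0$. A cyclic rotation of a string $y_0\cdots y_{\ell-1}$ is a string $y_t y_{t+1}\cdots y_{\ell-1}y_0\cdots y_{t-1}$. -}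

module Defs where

open import Data.Bool using (Bool; true; false; not; _∧_)
open import Data.Nat using (ℕ; zero; suc; _+_; _∸_; _⊔_; _<_; _%_)
open import Data.Nat.DivMod using (m%n<n)
open import Data.Bool.ListAction using (and)
open import Data.List using (List; []; _∷_; map; foldr; reverse; drop; take; _++_; concatMap; length)
open import Data.Vec using (Vec; toList; lookup)
open import Data.Fin using (fromℕ<)
open import Data.Product using (∃; _×_; _,_)
open import Relation.Binary.PropositionalEquality using (_≡_)

-- Bits: 0 is false, 1 is true.  min over bits is conjunction, 1 - b is not.

maxA : List ℕ → ℕ
maxA = foldr _⊔_ 0

-- lookup with default (never used out of range in the recurrence)
nth : List Bool → ℕ → Bool
nth []       _       = false
nth (x ∷ _)  zero    = x
nth (_ ∷ xs) (suc i) = nth xs i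

-- one step of the recurrence, given the history h with the most recent value
-- first: h[i] = w(n-1-i).  w(n) = 1 - min { w(n-x) : x ∈ A }.
step : List ℕ → List Bool → Bool
step A h = not (and (map (λ x → nth h (x ∸ 1)) A))

-- history before computing w(n): [w(n-1), w(n-2), ..., w(-α)]
-- initially reverse S = [s_α, ..., s_1] = [w(-1), ..., w(-α)].
hist : (A : List ℕ) → Vec Bool (maxA A) → ℕ → List Bool
hist A S zero    = reverse (toList S)
hist A S (suc n) = step A (hist A S n) ∷ hist A S n

w : (A : List ℕ) → Vec Bool (maxA A) → ℕ → Bool
w A S n = step A (hist A S n)

InW : List ℕ → (ℕ → Bool) → Set
InW A u = ∃ λ (S : Vec Bool (maxA A)) → ∀ n → w A S n ≡ u n

infWord : ∀ {k} → Vec Bool (suc k) → ℕ → Bool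
infWord {k} X n = lookup X (fromℕ< (m%n<n n (suc k)))

IsPeriod : (ℕ → Bool) → ℕ → Set
IsPeriod u p = ∀ n → u (n + p) ≡ u n

data Block : Set where
  b01 b011 : Block

blockStr : Block → List Bool
blockStr b01  = false ∷ true ∷ []
blockStr b011 = false ∷ true ∷ true ∷ []

rotate : ℕ → List Bool → List Bool
rotate t y = drop t y ++ take t y

IsRotation : List Bool → List Bool → Set
IsRotation x y = ∃ λ t → t < length y × x ≡ rotate t y

RotOfBlocks : List Bool → Set
RotOfBlocks x = ∃ λ (bs : List Block) → IsRotation x (concatMap blockStr bs)

-- Let u = X^∞ have least period L.  Membership in 𝒲^{1,b} means u (n + b) = ¬ (u (n + b − 1) ∧ u n).
-- Going back b periods, a 0 at j forces u (j + 1) = 1, and then the recurrence carries every 0 at m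
-- to a 0 at m + b + 1.  A shift sending the zeros of a periodic word into themselves permutes them,
-- so b + 1 is a period, L ∣ b + 1, and the recurrence turns into the local rule
-- u (n + 1) = ¬ (u n ∧ u (n + 2)).  Conversely, a word of period b + 1 obeying the local rule satisfies
-- the recurrence, the seed being its periodic extension to the left.  Finally, the local rule says
-- that 0s are isolated and 111 does not occur, so read from any 0 one period splits into blocks
-- 01 and 011; and a cyclic word of such blocks obeys the rule because every block starts with 01.

module Submission where

open import Defs
open import Data.Nat using (ℕ; zero; suc; pred; _+_; _*_; _∸_; _≤_; _<_; s≤s; s≤s⁻¹; z<s; _%_; _/_)
open import Data.Nat.Properties hiding (_≟_)
open import Data.Nat.DivMod using (m%n<n; m≡m%n+[m/n]*n; [m+n]%n≡m%n; m<n⇒m%n≡m)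
open import Data.Nat.Divisibility using (_∣_; divides; m%n≡0⇒n∣m)
open import Data.Nat.Tactic.RingSolver using (solve-∀)
open import Data.Bool using (Bool; true; false; not; _∧_)
open import Data.Bool.Properties using (_≟_; ∧-identityʳ; ∧-zeroʳ; not-involutive; ¬-not)
open import Data.List using (List; []; _∷_; _++_; length; take; drop; reverse; applyUpTo; concatMap)
open import Data.List.Properties
  using (length-applyUpTo; take++drop≡id; ++-identityʳ; length-++; concatMap-++; reverse-involutive)
open import Data.Vec using (Vec; toList; lookup)
import Data.Vec as Vec
open import Data.Vec.Properties using (length-toList; toList-reverse)
open import Data.Fin using (fromℕ<)
open import Data.Fin.Properties using (fromℕ<-cong)
open import Data.Unit using (⊤; tt)
open import Data.Product using (_×_; _,_; ∃)
import Data.Product as Product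
open import Data.Product.Function.NonDependent.Propositional using (_×-⇔_)
open import Function using (_∘_)
open import Function.Bundles using (_⇔_; mk⇔)
open import Function.Construct.Composition using (_⇔-∘_)
open import Relation.Nullary using (yes; no; contradiction)
open import Relation.Binary.PropositionalEquality

private
  variable
    u : ℕ → Bool
    k : ℕ

-- Periodic words

period-multiple : ∀ {p} → IsPeriod u p → ∀ t n → u (n + t * p) ≡ u n
period-multiple {u} per zero n = cong u (+-identityʳ n)
period-multiple {u} {p} per (suc t) n = begin
  u (n + (p + t * p)) ≡⟨ cong u (trans (cong (n +_) (+-comm p (t * p))) (sym (+-assoc n (t * p) p))) ⟩
  u (n + t * p + p)   ≡⟨ per (n + t * p) ⟩
  u (n + t * p)       ≡⟨ period-multiple per t n ⟩
  u n                 ∎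
  where open ≡-Reasoning

period-mod : IsPeriod u (suc k) → ∀ n → u (n % suc k) ≡ u n
period-mod {u} {k} per n =
  trans (sym (period-multiple per (n / suc k) (n % suc k))) (cong u (sym (m≡m%n+[m/n]*n n (suc k))))

leastPeriod-∣ : ∀ {q} → IsPeriod u (suc k) → (∀ p → 0 < p → IsPeriod u p → suc k ≤ p)
              → IsPeriod u q → suc k ∣ q
leastPeriod-∣ {u} {k} {q} per least perq with q % suc k in q%L
... | zero  = m%n≡0⇒n∣m q (suc k) q%L
... | suc r = contradiction (least (suc r) z<s residue-period)
                            (<⇒≱ (subst (_< suc k) q%L (m%n<n q (suc k))))
  where
  open ≡-Reasoning
  q≡ : q ≡ suc r + q / suc k * suc k
  q≡ = trans (m≡m%n+[m/n]*n q (suc k)) (cong (_+ q / suc k * suc k) q%L)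
  residue-period : IsPeriod u (suc r)
  residue-period n = begin
    u (n + suc r)                        ≡⟨ period-multiple per (q / suc k) (n + suc r) ⟨
    u (n + suc r + q / suc k * suc k)    ≡⟨ cong u (+-assoc n (suc r) _) ⟩
    u (n + (suc r + q / suc k * suc k))  ≡⟨ cong (λ m → u (n + m)) q≡ ⟨
    u (n + q)                            ≡⟨ perq n ⟩
    u n                                  ∎

period⇔∣ : ∀ {q} → IsPeriod u (suc k) → (∀ p → 0 < p → IsPeriod u p → suc k ≤ p)
         → IsPeriod u q ⇔ suc k ∣ q
period⇔∣ {u} {k} per least = mk⇔ (leastPeriod-∣ per least) multiple
  where
  multiple : ∀ {q} → suc k ∣ q → IsPeriod u q
  multiple (divides t refl) = period-multiple per t

≡-from-falses : ∀ x y → (x ≡ false → y ≡ false) → (y ≡ false → x ≡ false) → x ≡ y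
≡-from-falses false _     x⇒y _   = sym (x⇒y refl)
≡-from-falses true  false _   y⇒x = y⇒x refl
≡-from-falses true  true  _   _   = refl

-- If u (n + d) is 0, then so is u (n + d + k * d) = u (n + d * suc k), which is u n.
falses-closed⇒period : ∀ {d} → IsPeriod u (suc k) → (∀ m → u m ≡ false → u (m + d) ≡ false)
                     → IsPeriod u d
falses-closed⇒period {u} {k} {d} per closed n =
  sym (≡-from-falses (u n) (u (n + d)) (closed n) reflect)
  where
  iterate : ∀ t m → u m ≡ false → u (m + t * d) ≡ false
  iterate zero    m uₘ = trans (cong u (+-identityʳ m)) uₘ
  iterate (suc t) m uₘ =
    trans (cong u (sym (+-assoc m d (t * d))))
          (iterate t (m + d) (closed m uₘ))
  reflect : u (n + d) ≡ false → u n ≡ false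
  reflect uₙ₊d = begin
    u n                     ≡⟨ period-multiple per d n ⟨
    u (n + d * suc k)       ≡⟨ cong u (regroup n d k) ⟩
    u (n + d + k * d)       ≡⟨ iterate k (n + d) uₙ₊d ⟩
    false                   ∎
    where
    open ≡-Reasoning
    regroup : ∀ n d k → n + d * suc k ≡ n + d + k * d
    regroup = solve-∀

-- The recurrence of 𝒲^{1,b} and the local nand rule

NandRecurrence : ℕ → (ℕ → Bool) → Set
NandRecurrence b u = ∀ m → u (b + m) ≡ not (u (pred b + m) ∧ u m)

NandAt : (ℕ → Bool) → ℕ → Set
NandAt u n = u (1 + n) ≡ not (u n ∧ u (2 + n))

NandLocal : (ℕ → Bool) → Set
NandLocal u = ∀ n → NandAt u n

cong-nand : ∀ {x x′ y y′} → x ≡ x′ → y ≡ y′ → not (x ∧ y) ≡ not (x′ ∧ y′)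
cong-nand = cong₂ (λ x y → not (x ∧ y))

nandAt-transport : ∀ {v u : ℕ → Bool} {m n} → (∀ j → v (j + m) ≡ u (j + n)) → NandAt v m → NandAt u n
nandAt-transport same nandₘ =
  trans (sym (same 1)) (trans nandₘ (cong-nand (same 0) (same 2)))

nandLocal-shift : NandLocal u → ∀ s → NandLocal (λ i → u (s + i))
nandLocal-shift {u} nand s n =
  nandAt-transport {u} {λ i → u (s + i)} same (nand (s + n))
  where
  same : ∀ j → u (j + (s + n)) ≡ u (s + (j + n))
  same j = cong u (trans (+-comm j (s + n)) (trans (+-assoc s n j) (cong (s +_) (+-comm n j))))

periodic-nandLocal-unshift : ∀ s → IsPeriod u (suc k) → NandLocal (λ i → u (s + i)) → NandLocal u
periodic-nandLocal-unshift {u} {k} s per nand n = nandAt-transport {v = λ i → u (s + i)} {u} same (nand (n + s * k))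
  where
  same : ∀ j → u (s + (j + (n + s * k))) ≡ u (j + n)
  same j = trans (cong u (regroup s j n k)) (period-multiple per s (j + n))
    where
    regroup : ∀ s j n k → s + (j + (n + s * k)) ≡ j + n + s * suc k
    regroup = solve-∀

nandLocal-mod : IsPeriod u (suc k) → (∀ r → r < suc k → NandAt u r) → NandLocal u
nandLocal-mod {u} {k} per nand n = nandAt-transport {u} {u} same (nand (n % suc k) (m%n<n n (suc k)))
  where
  same : ∀ j → u (j + n % suc k) ≡ u (j + n)
  same j = trans (sym (period-multiple per (n / suc k) (j + n % suc k)))
                 (cong u (trans (+-assoc j _ _) (cong (j +_) (sym (m≡m%n+[m/n]*n n (suc k))))))

nandLocal-false⇒true : NandLocal u → ∀ n → u n ≡ false → u (1 + n) ≡ true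
nandLocal-false⇒true {u} nand n uₙ = trans (nand n) (cong-nand uₙ refl)

nandLocal-true-true⇒false : NandLocal u → ∀ n → u (1 + n) ≡ true → u (2 + n) ≡ true → u (3 + n) ≡ false
nandLocal-true-true⇒false {u} nand n u₁ u₂ =
  trans (sym (not-involutive (u (3 + n))))
        (cong not (sym (trans (sym u₂) (trans (nand (1 + n)) (cong-nand u₁ refl)))))

nandLocal-∃false : NandLocal u → ∃ λ n → u n ≡ false
nandLocal-∃false {u} nand with u 0 in u₀ | u 2 in u₂
... | false | _     = 0 , u₀
... | true  | false = 2 , u₂
... | true  | true  = 1 , trans (nand 0) (cong-nand u₀ u₂)

module _ (c : ℕ) where

  private
    b : ℕ
    b = suc c

  -- Moved on by b periods, j + 1 becomes the position m + b of the recurrence, and m + b − 1 carries u j = 0.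
  nandRecurrence-false⇒true : IsPeriod u (suc k) → NandRecurrence b u → ∀ j → u j ≡ false → u (suc j) ≡ true
  nandRecurrence-false⇒true {u} {k} per rec j uⱼ = begin
    u (suc j)                        ≡⟨ period-multiple per b (suc j) ⟨
    u (suc j + b * suc k)            ≡⟨ cong (u ∘ suc) (ring₁ j k c) ⟩
    u (suc (c + m))                  ≡⟨ rec m ⟩
    not (u (c + m) ∧ u m)            ≡⟨ cong-nand (trans (cong u (ring₂ j k c)) (period-multiple per b j)) refl ⟩
    not (u j ∧ u m)                  ≡⟨ cong-nand uⱼ refl ⟩
    true                             ∎
    where
    open ≡-Reasoning
    m : ℕ
    m = suc j + k * b
    ring₁ : ∀ j k c → j + suc c * suc k ≡ c + (suc j + k * suc c)
    ring₁ = solve-∀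
    ring₂ : ∀ j k c → c + (suc j + k * suc c) ≡ j + suc c * suc k
    ring₂ = solve-∀

  nandRecurrence-falses-closed : IsPeriod u (suc k) → NandRecurrence b u
                               → ∀ m → u m ≡ false → u (m + suc b) ≡ false
  nandRecurrence-falses-closed {u} per rec m uₘ = begin
    u (m + suc b)                          ≡⟨ cong u (regroup m c) ⟩
    u (suc (c + suc m))                    ≡⟨ rec (suc m) ⟩
    not (u (c + suc m) ∧ u (suc m))        ≡⟨ cong-nand uₘ₊b (nandRecurrence-false⇒true per rec m uₘ) ⟩
    false                                  ∎
    where
    open ≡-Reasoning
    uₘ₊b : u (c + suc m) ≡ true
    uₘ₊b = begin
      u (c + suc m)            ≡⟨ cong u (+-suc c m) ⟩
      u (suc (c + m))          ≡⟨ rec m ⟩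
      not (u (c + m) ∧ u m)    ≡⟨ cong-nand refl uₘ ⟩
      not (u (c + m) ∧ false)  ≡⟨ cong not (∧-zeroʳ (u (c + m))) ⟩
      true                     ∎
    regroup : ∀ m c → m + suc (suc c) ≡ suc (c + suc m)
    regroup = solve-∀

  nandRecurrence⇒period : IsPeriod u (suc k) → NandRecurrence b u → IsPeriod u (suc b)
  nandRecurrence⇒period per rec = falses-closed⇒period per (nandRecurrence-falses-closed per rec)

  nandRecurrence⇒nandLocal : IsPeriod u (suc b) → NandRecurrence b u → NandLocal u
  nandRecurrence⇒nandLocal {u} per rec n = begin
    u (suc n)                                  ≡⟨ per (suc n) ⟨
    u (suc n + suc b)                          ≡⟨ cong u (regroup₁ n c) ⟩
    u (suc (c + (2 + n)))                      ≡⟨ rec (2 + n) ⟩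
    not (u (c + (2 + n)) ∧ u (2 + n))          ≡⟨ cong-nand (trans (cong u (regroup₂ n c)) (per n)) refl ⟩
    not (u n ∧ u (2 + n))                      ∎
    where
    open ≡-Reasoning
    regroup₁ : ∀ n c → suc n + suc (suc c) ≡ suc (c + suc (suc n))
    regroup₁ = solve-∀
    regroup₂ : ∀ n c → c + suc (suc n) ≡ n + suc (suc c)
    regroup₂ = solve-∀

  nandLocal⇒nandRecurrence : IsPeriod u (suc b) → NandLocal u → NandRecurrence b u
  nandLocal⇒nandRecurrence {u} per nand m =
    trans (nand (c + m)) (cong-nand refl (trans (cong u (regroup c m)) (per m)))
    where
    regroup : ∀ c m → suc (suc (c + m)) ≡ m + suc (suc c)
    regroup = solve-∀

nth-hist : ∀ A S n i → i < n → nth (hist A S n) i ≡ w A S (n ∸ suc i)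
nth-hist A S (suc n) zero    _         = refl
nth-hist A S (suc n) (suc i) (s≤s i<n) = nth-hist A S n i i<n

module _ (c : ℕ) where

  private
    b : ℕ
    b = suc c
    A : List ℕ
    A = 1 ∷ b ∷ []

  InW⇒nandRecurrence : InW A u → NandRecurrence b u
  InW⇒nandRecurrence {u} (S , w≡u) m = begin
    u (suc (c + m))                         ≡⟨ w≡u (suc (c + m)) ⟨
    not (w A S (c + m) ∧ (nth h c ∧ true))  ≡⟨ cong-nand refl (∧-identityʳ (nth h c)) ⟩
    not (w A S (c + m) ∧ nth h c)           ≡⟨ cong-nand refl nth-h-c ⟩
    not (w A S (c + m) ∧ w A S m)           ≡⟨ cong-nand (w≡u (c + m)) (w≡u m) ⟩
    not (u (c + m) ∧ u m)                   ∎
    where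
    open ≡-Reasoning
    h : List Bool
    h = hist A S (suc (c + m))
    nth-h-c : nth h c ≡ w A S m
    nth-h-c = trans (nth-hist A S (suc (c + m)) c (s≤s (m≤m+n c m))) (cong (w A S) (m+n∸m≡n c m))

  descending : (ℕ → Bool) → (n : ℕ) → Vec Bool n
  descending u zero    = Vec.[]
  descending u (suc n) = u (suc n) Vec.∷ descending u n

  nth-descending : ∀ n i → i < n → nth (toList (descending u n)) i ≡ u (n ∸ i)
  nth-descending (suc n) zero    _         = refl
  nth-descending (suc n) (suc i) (s≤s i<n) = nth-descending n i i<n

  -- The seed is the periodic extension of u to the left: w (−b), …, w (−1) are u 1, …, u b.
  nandRecurrence⇒InW : IsPeriod u (suc b) → NandRecurrence b u → InW A u
  nandRecurrence⇒InW {u} per rec = S , w≡u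
    where
    S : Vec Bool b
    S = Vec.reverse (descending u b)

    hist-correct : ∀ n i → i < n + b → nth (hist A S n) i ≡ u (n + b ∸ i)
    hist-correct zero i i<b = trans (cong (λ h → nth h i) initial) (nth-descending b i i<b)
      where
      initial : reverse (toList S) ≡ toList (descending u b)
      initial = trans (cong reverse (toList-reverse (descending u b))) (reverse-involutive _)
    hist-correct (suc n) zero _ = begin
      not (nth h 0 ∧ (nth h c ∧ true))  ≡⟨ cong (not ∘ (nth h 0 ∧_)) (∧-identityʳ (nth h c)) ⟩
      not (nth h 0 ∧ nth h c)           ≡⟨ cong-nand (hist-correct n 0 0<n+b) (hist-correct n c c<n+b) ⟩
      not (u (n + b) ∧ u (n + b ∸ c))   ≡⟨ cong-nand (cong u n+b≡c+1+n) (cong u n+b∸c≡1+n) ⟩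
      not (u (c + suc n) ∧ u (suc n))   ≡⟨ rec (suc n) ⟨
      u (suc (c + suc n))               ≡⟨ cong (u ∘ suc) n+b≡c+1+n ⟨
      u (suc n + b)                     ∎
      where
      open ≡-Reasoning
      h : List Bool
      h = hist A S n
      0<n+b : 0 < n + b
      0<n+b = ≤-trans z<s (m≤n+m b n)
      c<n+b : c < n + b
      c<n+b = m≤n+m b n
      n+b≡c+1+n : n + b ≡ c + suc n
      n+b≡c+1+n = trans (+-comm n b) (sym (+-suc c n))
      n+b∸c≡1+n : n + b ∸ c ≡ suc n
      n+b∸c≡1+n = trans (cong (_∸ c) (+-suc n c)) (m+n∸n≡m (suc n) c)
    hist-correct (suc n) (suc i) i<n+b = hist-correct n i (s≤s⁻¹ i<n+b)

    w≡u : ∀ n → w A S n ≡ u n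
    w≡u n = trans (hist-correct (suc n) 0 z<s) (trans (cong u (sym (+-suc n b))) (per n))

periodic-InW⇔ : ∀ c → IsPeriod u (suc k)
              → InW (1 ∷ suc c ∷ []) u ⇔ (IsPeriod u (suc (suc c)) × NandLocal u)
periodic-InW⇔ c per = mk⇔
  (λ inW → let rec = InW⇒nandRecurrence c inW
               perᵇ = nandRecurrence⇒period c per rec
           in perᵇ , nandRecurrence⇒nandLocal c perᵇ rec)
  (λ (perᵇ , nand) → nandRecurrence⇒InW c perᵇ (nandLocal⇒nandRecurrence c perᵇ nand))

-- Finite windows and rotations

applyUpTo-cong : ∀ {A : Set} {f g : ℕ → A} → (∀ i → f i ≡ g i) → ∀ n → applyUpTo f n ≡ applyUpTo g n
applyUpTo-cong f≗g zero    = refl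
applyUpTo-cong f≗g (suc n) = cong₂ _∷_ (f≗g 0) (applyUpTo-cong (f≗g ∘ suc) n)

applyUpTo-+ : ∀ {A : Set} (f : ℕ → A) m n → applyUpTo f (m + n) ≡ applyUpTo f m ++ applyUpTo (λ i → f (m + i)) n
applyUpTo-+ f zero    n = refl
applyUpTo-+ f (suc m) n = cong (f 0 ∷_) (applyUpTo-+ (f ∘ suc) m n)

applyUpTo-period-+ : ∀ {L} → IsPeriod u L → ∀ n → applyUpTo u (L + n) ≡ applyUpTo u L ++ applyUpTo u n
applyUpTo-period-+ {u} {L} per n =
  trans (applyUpTo-+ u L n) (cong (applyUpTo u L ++_) (applyUpTo-cong (λ i → trans (cong u (+-comm L i)) (per i)) n))

toList-applyUpTo : ∀ {n} (X : Vec Bool n) (f : ℕ → Bool)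
                 → (∀ i (i<n : i < n) → f i ≡ lookup X (fromℕ< i<n)) → toList X ≡ applyUpTo f n
toList-applyUpTo Vec.[]       f f≡ = refl
toList-applyUpTo (x Vec.∷ X) f f≡ =
  cong₂ _∷_ (sym (f≡ 0 z<s)) (toList-applyUpTo X (f ∘ suc) (λ i i<n → f≡ (suc i) (s≤s i<n)))

infWord-period : (X : Vec Bool (suc k)) → IsPeriod (infWord X) (suc k)
infWord-period {k} X n = cong (lookup X) (fromℕ<-cong _ _ ([m+n]%n≡m%n n (suc k)) _ _)

toList-infWord : (X : Vec Bool (suc k)) → toList X ≡ applyUpTo (infWord X) (suc k)
toList-infWord {k} X = toList-applyUpTo X (infWord X)
  (λ i i<L → cong (lookup X) (fromℕ<-cong _ _ (m<n⇒m%n≡m i<L) _ _))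

rotate-++ : ∀ (xs ys : List Bool) → rotate (length xs) (xs ++ ys) ≡ ys ++ xs
rotate-++ xs ys = cong₂ _++_ (drop-length xs) (take-length xs)
  where
  drop-length : ∀ (xs : List Bool) → drop (length xs) (xs ++ ys) ≡ ys
  drop-length []       = refl
  drop-length (x ∷ xs) = drop-length xs
  take-length : ∀ (xs : List Bool) → take (length xs) (xs ++ ys) ≡ xs
  take-length []       = refl
  take-length (x ∷ xs) = cong (x ∷_) (take-length xs)

rotate-inverse : ∀ t (ys : List Bool) → t < length ys → IsRotation ys (rotate t ys)
rotate-inverse zero    (y ∷ ys) _ = 0 , z<s , sym (trans (++-identityʳ _) (++-identityʳ (y ∷ ys)))
rotate-inverse (suc t) (y ∷ ys) _ = length (drop t ys) , shorter , sym back
  where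
  shorter : length (drop t ys) < length (drop t ys ++ y ∷ take t ys)
  shorter = subst (length (drop t ys) <_) (sym (length-++ (drop t ys))) (m<m+n _ z<s)
  back : rotate (length (drop t ys)) (drop t ys ++ y ∷ take t ys) ≡ y ∷ ys
  back = trans (rotate-++ (drop t ys) (y ∷ take t ys)) (cong (y ∷_) (take++drop≡id t ys))

rotate-applyUpTo : ∀ {t L} {f : ℕ → Bool} → IsPeriod f L → t ≤ L
                 → rotate t (applyUpTo f L) ≡ applyUpTo (λ i → f (t + i)) L
rotate-applyUpTo {t} {L} {f} per t≤L with m≤n⇒∃[o]m+o≡n t≤L
... | s , refl = begin
  rotate t (applyUpTo f (t + s))                          ≡⟨ cong (rotate t) (applyUpTo-+ f t s) ⟩
  rotate t (applyUpTo f t ++ tail)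
    ≡⟨ cong (λ n → rotate n (applyUpTo f t ++ tail)) (length-applyUpTo f t) ⟨
  rotate (length (applyUpTo f t)) (applyUpTo f t ++ tail) ≡⟨ rotate-++ (applyUpTo f t) tail ⟩
  tail ++ applyUpTo f t                                   ≡⟨ cong (tail ++_) (applyUpTo-cong wrap t) ⟩
  tail ++ applyUpTo (λ i → f (t + (s + i))) t             ≡⟨ applyUpTo-+ (λ i → f (t + i)) s t ⟨
  applyUpTo (λ i → f (t + i)) (s + t)                     ≡⟨ cong (applyUpTo (λ i → f (t + i))) (+-comm s t) ⟩
  applyUpTo (λ i → f (t + i)) (t + s)                     ∎
  where
  open ≡-Reasoning
  tail : List Bool
  tail = applyUpTo (λ i → f (t + i)) s
  wrap : ∀ i → f i ≡ f (t + (s + i))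
  wrap i = sym (trans (cong f (regroup t s i)) (per i))
    where
    regroup : ∀ t s i → t + (s + i) ≡ i + (t + s)
    regroup = solve-∀

-- Words built from the blocks 01 and 011

NandChain : List Bool → Set
NandChain (a ∷ m ∷ c ∷ r) = m ≡ not (a ∧ c) × NandChain (m ∷ c ∷ r)
NandChain _               = ⊤

nandChain-blocks : ∀ bs → NandChain (concatMap blockStr bs)
nandChain-blocks []                   = tt
nandChain-blocks (b01 ∷ [])           = tt
nandChain-blocks (b011 ∷ [])          = refl , tt
nandChain-blocks (b01 ∷ bs@(b01 ∷ _))   = refl , refl , nandChain-blocks bs
nandChain-blocks (b01 ∷ bs@(b011 ∷ _))  = refl , refl , nandChain-blocks bs
nandChain-blocks (b011 ∷ bs@(b01 ∷ _))  = refl , refl , refl , nandChain-blocks bs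
nandChain-blocks (b011 ∷ bs@(b011 ∷ _)) = refl , refl , refl , nandChain-blocks bs

nandChain⇒nandAt : ∀ m → NandChain (applyUpTo u m) → ∀ n → 2 + n < m → NandAt u n
nandChain⇒nandAt (suc zero)          _ n (s≤s ())
nandChain⇒nandAt (suc (suc zero))    _ n (s≤s (s≤s ()))
nandChain⇒nandAt (suc (suc (suc m))) (nand₀ , _)    zero    _         = nand₀
nandChain⇒nandAt {u} (suc (suc (suc m))) (_ , chain) (suc n) (s≤s 2+n<m) =
  nandChain⇒nandAt {λ i → u (suc i)} (suc (suc m)) chain n 2+n<m

-- Three periods contain the window u r, u (1 + r), u (2 + r) for every r below the period.
blocks⇒nandLocal : ∀ {bs} → IsPeriod u (suc k) → applyUpTo u (suc k) ≡ concatMap blockStr bs → NandLocal u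
blocks⇒nandLocal {u} {k} {bs} per period≡blocks =
  nandLocal-mod per (λ r r<L → nandChain⇒nandAt {u = u} (L + (L + L)) chain r (+-mono-≤ z<s (+-mono-≤ z<s r<L)))
  where
  L : ℕ
  L = suc k
  three-periods : applyUpTo u (L + (L + L)) ≡ concatMap blockStr (bs ++ bs ++ bs)
  three-periods = begin
    applyUpTo u (L + (L + L))                        ≡⟨ applyUpTo-period-+ per (L + L) ⟩
    applyUpTo u L ++ applyUpTo u (L + L)             ≡⟨ cong (applyUpTo u L ++_) (applyUpTo-period-+ per L) ⟩
    applyUpTo u L ++ applyUpTo u L ++ applyUpTo u L  ≡⟨ cong (λ x → x ++ x ++ x) period≡blocks ⟩
    y ++ y ++ y                                      ≡⟨ cong (y ++_) (concatMap-++ blockStr bs bs) ⟨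
    y ++ concatMap blockStr (bs ++ bs)               ≡⟨ concatMap-++ blockStr bs (bs ++ bs) ⟨
    concatMap blockStr (bs ++ bs ++ bs)              ∎
    where
    open ≡-Reasoning
    y : List Bool
    y = concatMap blockStr bs
  chain : NandChain (applyUpTo u (L + (L + L)))
  chain = subst NandChain (sym three-periods) (nandChain-blocks (bs ++ bs ++ bs))

nandLocal⇒blocks : NandLocal u → u 0 ≡ false → ∀ n → u n ≡ false
                 → ∃ λ bs → applyUpTo u n ≡ concatMap blockStr bs
nandLocal⇒blocks nand u₀ zero _ = [] , refl
nandLocal⇒blocks {u} nand u₀ (suc zero) u₁ =
  contradiction (trans (sym u₁) (nandLocal-false⇒true {u} nand 0 u₀)) λ ()
nandLocal⇒blocks {u} nand u₀ (suc (suc n)) uₙ with u 2 ≟ false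
... | yes u₂ = Product.map (b01 ∷_) (cong₂ _∷_ u₀ ∘ cong₂ _∷_ (nandLocal-false⇒true {u} nand 0 u₀))
                 (nandLocal⇒blocks {λ i → u (2 + i)} (nand ∘ (2 +_)) u₂ n uₙ)
nandLocal⇒blocks nand u₀ (suc (suc zero)) uₙ | no u₂≢false = contradiction uₙ u₂≢false
nandLocal⇒blocks {u} nand u₀ (suc (suc (suc n))) uₙ | no u₂≢false =
  Product.map (b011 ∷_) (cong₂ _∷_ u₀ ∘ cong₂ _∷_ u₁ ∘ cong₂ _∷_ u₂)
    (nandLocal⇒blocks {λ i → u (3 + i)} (nand ∘ (3 +_)) u₃ n uₙ)
  where
  u₁ : u 1 ≡ true
  u₁ = nandLocal-false⇒true {u} nand 0 u₀
  u₂ : u 2 ≡ true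
  u₂ = ¬-not u₂≢false
  u₃ : u 3 ≡ false
  u₃ = nandLocal-true-true⇒false {u} nand 0 u₁ u₂

nandLocal⇔rotOfBlocks : (X : Vec Bool (suc k)) → NandLocal (infWord X) ⇔ RotOfBlocks (toList X)
nandLocal⇔rotOfBlocks {k} X = mk⇔ to from
  where
  X∞ : ℕ → Bool
  X∞ = infWord X
  xs : List Bool
  xs = toList X
  L : ℕ
  L = suc k
  per : IsPeriod X∞ L
  per = infWord-period X
  length-xs : length xs ≡ L
  length-xs = length-toList X

  to : NandLocal X∞ → RotOfBlocks xs
  to nand with nandLocal-∃false {X∞} nand
  ... | p , X∞ₚ = rotation-of (nandLocal⇒blocks {λ i → X∞ (r + i)} (nandLocal-shift {X∞} nand r) X∞ᵣ L X∞ᵣ₊L)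
    where
    r : ℕ
    r = p % L
    r<L : r < L
    r<L = m%n<n p L
    X∞ᵣ : X∞ (r + 0) ≡ false
    X∞ᵣ = trans (cong X∞ (+-identityʳ r)) (trans (period-mod per p) X∞ₚ)
    X∞ᵣ₊L : X∞ (r + L) ≡ false
    X∞ᵣ₊L = trans (per r) (trans (period-mod per p) X∞ₚ)
    rotation-of : (∃ λ bs → applyUpTo (λ i → X∞ (r + i)) L ≡ concatMap blockStr bs) → RotOfBlocks xs
    rotation-of (bs , window≡blocks) =
      bs , subst (IsRotation xs) rotation≡blocks (rotate-inverse r xs (subst (r <_) (sym length-xs) r<L))
      where
      rotation≡blocks : rotate r xs ≡ concatMap blockStr bs
      rotation≡blocks = trans (cong (rotate r) (toList-infWord X)) (trans (rotate-applyUpTo per (<⇒≤ r<L)) window≡blocks)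

  from : RotOfBlocks xs → NandLocal X∞
  from (bs , t , t<length , xs≡) = unrotate (rotate-inverse t ys t<length)
    where
    ys : List Bool
    ys = concatMap blockStr bs
    unrotate : IsRotation ys (rotate t ys) → NandLocal X∞
    unrotate (s , s<length , ys≡) =
      periodic-nandLocal-unshift s per (blocks⇒nandLocal {λ i → X∞ (s + i)} {bs = bs} shifted-per window≡blocks)
      where
      s<L : s < L
      s<L = subst (s <_) (trans (cong length (sym xs≡)) length-xs) s<length
      shifted-per : IsPeriod (λ i → X∞ (s + i)) L
      shifted-per n = trans (cong X∞ (sym (+-assoc s n L))) (per (s + n))
      window≡blocks : applyUpTo (λ i → X∞ (s + i)) L ≡ ys
      window≡blocks = begin
        applyUpTo (λ i → X∞ (s + i)) L  ≡⟨ rotate-applyUpTo per (<⇒≤ s<L) ⟨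
        rotate s (applyUpTo X∞ L)       ≡⟨ cong (rotate s) (toList-infWord X) ⟨
        rotate s xs                     ≡⟨ cong (rotate s) xs≡ ⟩
        rotate s (rotate t ys)          ≡⟨ ys≡ ⟨
        ys                              ∎
        where open ≡-Reasoning

theorem3p5 : (b : ℕ) → 2 ≤ b → (k : ℕ) → (X : Vec Bool (suc k))
    → (∀ p → 0 < p → IsPeriod (infWord X) p → suc k ≤ p)
    → InW (1 ∷ b ∷ []) (infWord X) ⇔ (suc k ∣ suc b × RotOfBlocks (toList X))
theorem3p5 zero    ()
-- The argument only needs b ≥ 1.
theorem3p5 (suc c) _ k X least =
  (period⇔∣ per least ×-⇔ nandLocal⇔rotOfBlocks X) ⇔-∘ periodic-InW⇔ c per
  where
  per : IsPeriod (infWord X) (suc k)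
  per = infWord-period X
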